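{- Let $\mathcal{G}=(V,E,\mathcal{E})$ be an extended graph and let $v\in V$ satisfy $\deg(v)=2$ with $N(v)=\{u,w\}$, where $N(u)=N(w)$ and $\deg_2(v)\le\deg(u)-1$. Then $v$ is contained in some maximum 2-packing set of $\mathcal{G}$. Consequently, with $\mathcal{G}'=\mathcal{G}[V\setminus N^2[v]]$, we have $\beta(\mathcal{G})=\beta(\mathcal{G}')+1$.
   Context: Let $H=(V_H,E_H)$ be a finite simple undirected graph and let $\mathcal{E}_H$ be the set of unordered pairs $\{x,y\}$ of distinct vertices with $\{x,y\}\notin E_H$ that have a common neighbor in $H$. An extended graph $\mathcal{G}=(V,E,\mathcal{E})$ is obtained from such an $H$ by choosing $V\subseteq V_H$ and letting $E$ (resp. $\mathcal{E}$) be the pairs of $E_H$ (resp. $\mathcal{E}_H$) with both endpoints in $V$. For $U\subseteq V$, $\mathcal{G}[U]$ denotes the extended graph on $U$ keeping exactly the pairs of $E$ and of $\mathcal{E}$ with both endpoints in $U$. For $v\in V$: $N(v)=\{x:\{x,v\}\in E\}$, $N[v]=N(v)\cup\{v\}$, $\deg(v)=|N(v)|$, $N^2(v)=\{x:\{x,v\}\in\mathcal{E}\}$, $N^2[v]=N^2(v)\cup N[v]$, $\deg_2(v)=|N^2(v)|$. A 2-packing set of $\mathcal{G}$ is a set $S\subseteq V$ such that no two distinct vertices of $S$ form a pair in $E\cup\mathcal{E}$; a maximum 2-packing set is one of maximum cardinality, and $\beta(\mathcal{G})$ is this maximum cardinality. -}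

module Defs where

open import Data.Nat using (ℕ; _≤_)
open import Data.Bool using (Bool; true; false; _∧_; not)
open import Data.Fin using (Fin; _≟_)
open import Data.Fin.Subset using (Subset; _∈_; _⊆_; _∪_; _∩_; ∁; ⁅_⁆; ∣_∣)
open import Data.Vec using (lookup; tabulate)
open import Data.List using (allFin)
open import Data.Bool.ListAction using (any)
open import Relation.Nullary using (does; ¬_)
open import Relation.Binary.PropositionalEquality using (_≡_; _≢_)

record SimpleGraph (n : ℕ) : Set where
  field
    adj    : Fin n → Fin n → Bool
    sym    : ∀ x y → adj x y ≡ adj y x
    irrefl : ∀ x → adj x x ≡ false

open SimpleGraph public

commonNbr : ∀ {n} → SimpleGraph n → Fin n → Fin n → Bool
commonNbr {n} H x y = any (λ z → adj H x z ∧ adj H z y) (allFin n)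

ext : ∀ {n} → SimpleGraph n → Fin n → Fin n → Bool
ext H x y = not (does (x ≟ y)) ∧ not (adj H x y) ∧ commonNbr H x y

-- An extended graph: the host graph H together with the chosen vertex set V ⊆ V_H.
record ExtGraph (n : ℕ) : Set where
  constructor mkExt
  field
    host : SimpleGraph n
    V    : Subset n

open ExtGraph public

module _ {n : ℕ} (G : ExtGraph n) where
  inV : Fin n → Bool
  inV x = lookup (V G) x

  E : Fin n → Fin n → Bool
  E x y = inV x ∧ inV y ∧ adj (host G) x y

  𝓔 : Fin n → Fin n → Bool
  𝓔 x y = inV x ∧ inV y ∧ ext (host G) x y

  N : Fin n → Subset n
  N v = tabulate (λ x → E x v)

  N[_] : Fin n → Subset n
  N[ v ] = N v ∪ ⁅ v ⁆

  deg : Fin n → ℕ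
  deg v = ∣ N v ∣

  N² : Fin n → Subset n
  N² v = tabulate (λ x → 𝓔 x v)

  N²[_] : Fin n → Subset n
  N²[ v ] = N² v ∪ N[ v ]

  deg₂ : Fin n → ℕ
  deg₂ v = ∣ N² v ∣

  IsTwoPacking : Subset n → Set
  IsTwoPacking S = S ⊆ V G × (∀ x y → x ∈ S → y ∈ S → x ≢ y →
                     (E x y ≡ false) × (𝓔 x y ≡ false))
    where open import Data.Product using (_×_)

  IsMaxTwoPacking : Subset n → Set
  IsMaxTwoPacking S = IsTwoPacking S × (∀ T → IsTwoPacking T → ∣ T ∣ ≤ ∣ S ∣)
    where open import Data.Product using (_×_)

  -- 𝒢[U]: keep exactly the pairs of E and 𝓔 with both endpoints in U
  -- (same host graph, vertex set V ∩ U).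
  induced : Subset n → ExtGraph n
  induced U = mkExt (host G) (V G ∩ U)

{-# OPTIONS --safe #-}
module Submission where

-- Call x and y in conflict when {x, y} ∈ E ∪ 𝓔, so that 2-packings are the
-- independent sets of the conflict graph. Every neighbour of u other than v is
-- at distance two from v, and there are at least deg u − 1 ≥ deg₂ v of them,
-- so N²(v) ⊆ N(u). Then any two vertices of N²[v] = {v} ∪ N(v) ∪ N²(v) are in
-- conflict (through v, through u, or because N(x) = N(u) for x ∈ N(v)): v is
-- simplicial in the conflict graph. A 2-packing therefore meets N²[v] in at
-- most one vertex, and replacing that vertex by v yields a 2-packing of the
-- same size, which gives both claims.

open import Defs hiding (sym)
open import Data.Nat using (ℕ; zero; suc; z≤n; _≤_; _∸_; _+_; _≤?_)
open import Data.Nat.Properties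
  using (≤-trans; ≤-antisym; ≤-reflexive; +-suc; +-comm; +-identityʳ; +-monoˡ-≤; +-monoʳ-≤;
         ≰⇒>; <⇒≱; m≤n+m; m≤n+o⇒m∸n≤o)
open import Data.Fin using (Fin; _≟_)
open import Data.Fin.Subset
  using (Subset; _∈_; _∉_; _⊆_; _∪_; _∩_; ∁; ⁅_⁆; ∣_∣; ⊥; inside; outside)
open import Data.Fin.Subset.Properties
  using (_∈?_; _⊆?_; nonempty?; anySubset?; x∈p∪q⁻; x∈p∪q⁺; x∈p∩q⁻; x∈p∩q⁺; p∩q⊆p; p∩q⊆q;
         p⊆p∪q; x∈⁅x⁆; x∈⁅y⁆⇒x≡y; x∈∁p⇒x∉p; x∉⁅y⁆⇒x≢y; p⊂q⇒∣p∣<∣q∣;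
         p⊆q⇒∣p∣≤∣q∣; ∣p∣≤n; ∣p∩q∣≤∣q∣; ∣⊥∣≡0; ∣⁅x⁆∣≡1; Empty-unique; ∉⊥)
open import Data.Fin.Properties using (all?)
open import Data.Product using (_×_; Σ-syntax; ∃-syntax; _,_; proj₁; proj₂)
open import Data.Sum using (_⊎_; inj₁; inj₂) renaming (map to map-⊎)
open import Data.Bool using (Bool; true; false; _∧_; not)
open import Data.Bool.Properties using (¬-not; T-≡; ∧-comm) renaming (_≟_ to _≟ᵇ_)
open import Data.Vec using (_∷_; []; tabulate)
open import Data.Vec.Properties using (lookup∘tabulate; []=⇒lookup; lookup⇒[]=)
open import Data.List using (allFin)
open import Data.Bool.ListAction using (or)
open import Data.List.Properties using (map-cong)
open import Data.List.Relation.Unary.Any.Properties using (any⁺)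
open import Data.List.Membership.Propositional using (lose)
open import Data.List.Membership.Propositional.Properties using (∈-allFin)
open import Data.Empty using (⊥-elim)
open import Function using (_∘_)
open import Function.Bundles using (Equivalence)
open import Relation.Nullary using (yes; no; ¬_; does; contradiction)
open import Relation.Nullary.Decidable using (_×-dec_; _→-dec_; ¬?)
open import Relation.Unary using (Decidable)
open import Relation.Binary.PropositionalEquality
  using (_≡_; _≢_; refl; sym; trans; cong; cong₂; subst)

∧-true⁻ : ∀ {a b} → a ∧ b ≡ true → a ≡ true × b ≡ true
∧-true⁻ {true} {true} _ = refl , refl

∧-true⁺ : ∀ {a b} → a ≡ true → b ≡ true → a ∧ b ≡ true
∧-true⁺ refl refl = refl

true≢false : ∀ {b} → b ≡ true → b ≢ false
true≢false refl ()

does-≟-sym : ∀ {n} (x y : Fin n) → does (x ≟ y) ≡ does (y ≟ x)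
does-≟-sym x y with x ≟ y | y ≟ x
... | yes _ | yes _ = refl
... | no _  | no _  = refl
... | yes p | no ¬q = contradiction (sym p) ¬q
... | no ¬p | yes q = contradiction (sym q) ¬p

∈-tabulate⁻ : ∀ {n} (f : Fin n → Bool) {x} → x ∈ tabulate f → f x ≡ true
∈-tabulate⁻ f {x} x∈ = trans (sym (lookup∘tabulate f x)) ([]=⇒lookup x∈)

∈-tabulate⁺ : ∀ {n} (f : Fin n → Bool) {x} → f x ≡ true → x ∈ tabulate f
∈-tabulate⁺ f {x} fx = lookup⇒[]= x _ (trans (lookup∘tabulate f x) fx)

∣p∣≡∣p∩∁q∣+∣p∩q∣ : ∀ {n} (p q : Subset n) → ∣ p ∣ ≡ ∣ p ∩ ∁ q ∣ + ∣ p ∩ q ∣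
∣p∣≡∣p∩∁q∣+∣p∩q∣ []            []            = refl
∣p∣≡∣p∩∁q∣+∣p∩q∣ (inside ∷ p)  (inside ∷ q)  =
  trans (cong suc (∣p∣≡∣p∩∁q∣+∣p∩q∣ p q)) (sym (+-suc ∣ p ∩ ∁ q ∣ ∣ p ∩ q ∣))
∣p∣≡∣p∩∁q∣+∣p∩q∣ (inside ∷ p)  (outside ∷ q) = cong suc (∣p∣≡∣p∩∁q∣+∣p∩q∣ p q)
∣p∣≡∣p∩∁q∣+∣p∩q∣ (outside ∷ p) (inside ∷ q)  = ∣p∣≡∣p∩∁q∣+∣p∩q∣ p q
∣p∣≡∣p∩∁q∣+∣p∩q∣ (outside ∷ p) (outside ∷ q) = ∣p∣≡∣p∩∁q∣+∣p∩q∣ p q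

∣p∣≤∣p∩∁q∣+∣q∣ : ∀ {n} (p q : Subset n) → ∣ p ∣ ≤ ∣ p ∩ ∁ q ∣ + ∣ q ∣
∣p∣≤∣p∩∁q∣+∣q∣ p q =
  ≤-trans (≤-reflexive (∣p∣≡∣p∩∁q∣+∣p∩q∣ p q)) (+-monoʳ-≤ ∣ p ∩ ∁ q ∣ (∣p∩q∣≤∣q∣ p q))

∣p∣≤1 : ∀ {n} (p : Subset n) → (∀ {x y} → x ∈ p → y ∈ p → x ≡ y) → ∣ p ∣ ≤ 1
∣p∣≤1 {n} p unique with nonempty? p
... | yes (x , x∈p) = subst (∣ p ∣ ≤_) (∣⁅x⁆∣≡1 x)
                        (p⊆q⇒∣p∣≤∣q∣ λ y∈p → subst (_∈ ⁅ x ⁆) (unique x∈p y∈p) (x∈⁅x⁆ x))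
... | no empty      = subst (λ q → ∣ q ∣ ≤ 1) (sym (Empty-unique empty))
                        (subst (_≤ 1) (sym (∣⊥∣≡0 n)) z≤n)

x∉p⇒∣p∣+1≤∣p∪⁅x⁆∣ : ∀ {n} (p : Subset n) {x} → x ∉ p → ∣ p ∣ + 1 ≤ ∣ p ∪ ⁅ x ⁆ ∣
x∉p⇒∣p∣+1≤∣p∪⁅x⁆∣ p {x} x∉p = subst (_≤ ∣ p ∪ ⁅ x ⁆ ∣) (+-comm 1 ∣ p ∣)
  (p⊂q⇒∣p∣<∣q∣ (p⊆p∪q ⁅ x ⁆ , x , x∈p∪q⁺ (inj₂ (x∈⁅x⁆ x)) , x∉p))

∃-maximum-subset : ∀ {n} {P : Subset n → Set} → Decidable P → ∀ {S} → P S →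
                   ∃[ M ] (P M × (∀ T → P T → ∣ T ∣ ≤ ∣ M ∣))
∃-maximum-subset {n} {P} P? {S} PS = go n S PS (λ T _ → ≤-trans (∣p∣≤n T) (m≤n+m n ∣ S ∣))
  where
  go : ∀ slack S → P S → (∀ T → P T → ∣ T ∣ ≤ ∣ S ∣ + slack) →
       ∃[ M ] (P M × (∀ T → P T → ∣ T ∣ ≤ ∣ M ∣))
  go slack S PS bound with anySubset? (λ T → P? T ×-dec (suc ∣ S ∣ ≤? ∣ T ∣))
  ... | no ¬larger = S , PS , maximal
    where
    maximal : ∀ T → P T → ∣ T ∣ ≤ ∣ S ∣
    maximal T PT with ∣ T ∣ ≤? ∣ S ∣
    ... | yes T≤S = T≤S
    ... | no T≰S  = contradiction (T , PT , ≰⇒> T≰S) ¬larger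
  go zero       S PS bound | yes (T , PT , S<T) =
    contradiction (subst (∣ T ∣ ≤_) (+-identityʳ ∣ S ∣) (bound T PT)) (<⇒≱ S<T)
  go (suc slack) S PS bound | yes (T , PT , S<T) = go slack T PT λ R PR →
    ≤-trans (bound R PR) (≤-trans (≤-reflexive (+-suc ∣ S ∣ slack)) (+-monoˡ-≤ slack S<T))

module _ {n : ℕ} (G : ExtGraph n) where

  -- E G and 𝓔 G are definitionally within (adj (host G)) and within (ext (host G)).
  within : (Fin n → Fin n → Bool) → Fin n → Fin n → Bool
  within r x y = inV G x ∧ inV G y ∧ r x y

  within-true⁻ : ∀ r {x y} → within r x y ≡ true → x ∈ V G × y ∈ V G × r x y ≡ true
  within-true⁻ r {x} {y} rxy with ∧-true⁻ {inV G x} rxy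
  ... | x∈V , rest with ∧-true⁻ {inV G y} rest
  ... | y∈V , r′ = lookup⇒[]= x (V G) x∈V , lookup⇒[]= y (V G) y∈V , r′

  within-true⁺ : ∀ r {x y} → x ∈ V G → y ∈ V G → r x y ≡ true → within r x y ≡ true
  within-true⁺ r x∈V y∈V r′ = ∧-true⁺ ([]=⇒lookup x∈V) (∧-true⁺ ([]=⇒lookup y∈V) r′)

  within-sym : ∀ {r} → (∀ x y → r x y ≡ r y x) → ∀ x y → within r x y ≡ within r y x
  within-sym {r} r-sym x y with inV G x | inV G y
  ... | true  | true  = r-sym x y
  ... | true  | false = refl
  ... | false | true  = refl
  ... | false | false = refl

  commonNbr-sym : ∀ x y → commonNbr (host G) x y ≡ commonNbr (host G) y x
  commonNbr-sym x y = cong or (map-cong via (allFin n))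
    where
    via : ∀ z → (adj (host G) x z ∧ adj (host G) z y) ≡ (adj (host G) y z ∧ adj (host G) z x)
    via z rewrite SimpleGraph.sym (host G) x z | SimpleGraph.sym (host G) z y =
      ∧-comm (adj (host G) z x) (adj (host G) y z)

  ext-sym : ∀ x y → ext (host G) x y ≡ ext (host G) y x
  ext-sym x y = cong₂ _∧_ (cong not (does-≟-sym x y))
                          (cong₂ _∧_ (cong not (SimpleGraph.sym (host G) x y)) (commonNbr-sym x y))

  Conflict : Fin n → Fin n → Set
  Conflict x y = E G x y ≡ true ⊎ 𝓔 G x y ≡ true

  Conflict-sym : ∀ {x y} → Conflict x y → Conflict y x
  Conflict-sym {x} {y} (inj₁ e) = inj₁ (trans (within-sym (SimpleGraph.sym (host G)) y x) e)
  Conflict-sym {x} {y} (inj₂ e) = inj₂ (trans (within-sym ext-sym y x) e)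

  common-neighbour⇒Conflict : ∀ {x y z} → x ∈ N G z → y ∈ N G z → x ≢ y → Conflict x y
  common-neighbour⇒Conflict {x} {y} {z} x∈Nz y∈Nz x≢y = byAdjacency (adj (host G) x y) refl
    where
    xz : x ∈ V G × z ∈ V G × adj (host G) x z ≡ true
    xz = within-true⁻ (adj (host G)) (∈-tabulate⁻ _ x∈Nz)

    yz : y ∈ V G × z ∈ V G × adj (host G) y z ≡ true
    yz = within-true⁻ (adj (host G)) (∈-tabulate⁻ _ y∈Nz)

    x≢y′ : does (x ≟ y) ≢ true
    x≢y′ with x ≟ y
    ... | yes x≡y = contradiction x≡y x≢y
    ... | no _    = λ ()

    common : commonNbr (host G) x y ≡ true
    common = Equivalence.to T-≡ (any⁺ _ (lose (∈-allFin z) (Equivalence.from T-≡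
               (∧-true⁺ (proj₂ (proj₂ xz))
                        (trans (SimpleGraph.sym (host G) z y) (proj₂ (proj₂ yz)))))))

    byAdjacency : ∀ b → adj (host G) x y ≡ b → Conflict x y
    byAdjacency true  xy = inj₁ (within-true⁺ (adj (host G)) (proj₁ xz) (proj₁ yz) xy)
    byAdjacency false xy = inj₂ (within-true⁺ (ext (host G)) (proj₁ xz) (proj₁ yz)
                             (∧-true⁺ (cong not (¬-not x≢y′)) (∧-true⁺ (cong not xy) common)))

  Packing⇒¬Conflict : ∀ {S x y} → IsTwoPacking G S → x ∈ S → y ∈ S → x ≢ y → ¬ Conflict x y
  Packing⇒¬Conflict (_ , sep) x∈S y∈S x≢y (inj₁ e) = true≢false e (proj₁ (sep _ _ x∈S y∈S x≢y))
  Packing⇒¬Conflict (_ , sep) x∈S y∈S x≢y (inj₂ e) = true≢false e (proj₂ (sep _ _ x∈S y∈S x≢y))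

  ¬Conflict⇒Packing : ∀ {S} → S ⊆ V G → (∀ {x y} → x ∈ S → y ∈ S → x ≢ y → ¬ Conflict x y) →
                      IsTwoPacking G S
  ¬Conflict⇒Packing S⊆V free =
    S⊆V , λ x y x∈S y∈S x≢y → ¬-not (free x∈S y∈S x≢y ∘ inj₁) , ¬-not (free x∈S y∈S x≢y ∘ inj₂)

  Packing-⊆ : ∀ {S T} → T ⊆ S → IsTwoPacking G S → IsTwoPacking G T
  Packing-⊆ T⊆S (S⊆V , sep) = S⊆V ∘ T⊆S , λ x y x∈T y∈T → sep x y (T⊆S x∈T) (T⊆S y∈T)

  isTwoPacking? : Decidable (IsTwoPacking G)
  isTwoPacking? S = (S ⊆? V G) ×-dec all? λ x → all? λ y →
    (x ∈? S) →-dec (y ∈? S) →-dec ¬? (x ≟ y) →-dec ((E G x y ≟ᵇ false) ×-dec (𝓔 G x y ≟ᵇ false))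

  ∃-maximumTwoPacking : ∃[ S ] IsMaxTwoPacking G S
  ∃-maximumTwoPacking =
    ∃-maximum-subset isTwoPacking? {⊥} (⊥-elim ∘ ∉⊥ , λ _ _ x∈⊥ → ⊥-elim (∉⊥ x∈⊥))

  v∈N²[v] : ∀ v → v ∈ N²[_] G v
  v∈N²[v] v = x∈p∪q⁺ (inj₂ (x∈p∪q⁺ (inj₂ (x∈⁅x⁆ v))))

  Conflict⇒∈N²[] : ∀ {x v} → Conflict x v → x ∈ N²[_] G v
  Conflict⇒∈N²[] (inj₁ e) = x∈p∪q⁺ (inj₂ (x∈p∪q⁺ (inj₁ (∈-tabulate⁺ _ e))))
  Conflict⇒∈N²[] (inj₂ e) = x∈p∪q⁺ (inj₁ (∈-tabulate⁺ _ e))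

  ∈N⇒Conflict : ∀ {x v} → x ∈ N G v → Conflict x v
  ∈N⇒Conflict x∈Nv = inj₁ (∈-tabulate⁻ _ x∈Nv)

  ∈N-sym : ∀ {x y} → x ∈ N G y → y ∈ N G x
  ∈N-sym {x} {y} x∈Ny =
    ∈-tabulate⁺ _ (trans (within-sym (SimpleGraph.sym (host G)) y x) (∈-tabulate⁻ _ x∈Ny))

  ∉N-self : ∀ {x} → x ∉ N G x
  ∉N-self {x} x∈Nx =
    true≢false (proj₂ (proj₂ (within-true⁻ (adj (host G)) (∈-tabulate⁻ _ x∈Nx))))
               (SimpleGraph.irrefl (host G) x)

  ∈N²[]⁻ : ∀ {x v} → x ∈ N²[_] G v → x ∈ N² G v ⊎ x ∈ N G v ⊎ x ≡ v
  ∈N²[]⁻ {x} {v} x∈ with x∈p∪q⁻ (N² G v) (N[_] G v) x∈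
  ... | inj₁ x∈N² = inj₁ x∈N²
  ... | inj₂ x∈N[] with x∈p∪q⁻ (N G v) ⁅ v ⁆ x∈N[]
  ... | inj₁ x∈N = inj₂ (inj₁ x∈N)
  ... | inj₂ x≡v = inj₂ (inj₂ (x∈⁅y⁆⇒x≡y v x≡v))

  ∈N²[]⇒Conflict : ∀ {x v} → x ∈ N²[_] G v → x ≢ v → Conflict x v
  ∈N²[]⇒Conflict x∈ x≢v with ∈N²[]⁻ x∈
  ... | inj₁ x∈N²        = inj₂ (∈-tabulate⁻ _ x∈N²)
  ... | inj₂ (inj₁ x∈N)  = ∈N⇒Conflict x∈N
  ... | inj₂ (inj₂ x≡v)  = contradiction x≡v x≢v

  -- N²[v] is the closed neighbourhood of v in the conflict graph.
  IsSimplicial : Fin n → Set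
  IsSimplicial v = ∀ {x y} → x ∈ N²[_] G v → y ∈ N²[_] G v → x ≢ y → Conflict x y

module _ {n : ℕ} (G : ExtGraph n) (U : Subset n) where

  within-induced⁻ : ∀ r {x y} → within (induced G U) r x y ≡ true → within G r x y ≡ true
  within-induced⁻ r rxy with within-true⁻ (induced G U) r rxy
  ... | x∈V∩U , y∈V∩U , r′ =
    within-true⁺ G r (proj₁ (x∈p∩q⁻ _ _ x∈V∩U)) (proj₁ (x∈p∩q⁻ _ _ y∈V∩U)) r′

  within-induced⁺ : ∀ r {x y} → x ∈ U → y ∈ U → within G r x y ≡ true →
                    within (induced G U) r x y ≡ true
  within-induced⁺ r x∈U y∈U rxy with within-true⁻ G r rxy
  ... | x∈V , y∈V , r′ = within-true⁺ (induced G U) r (x∈p∩q⁺ (x∈V , x∈U)) (x∈p∩q⁺ (y∈V , y∈U)) r′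

  Packing-induced⁺ : ∀ {S} → IsTwoPacking G S → S ⊆ U → IsTwoPacking (induced G U) S
  Packing-induced⁺ S-packing S⊆U = ¬Conflict⇒Packing (induced G U)
    (λ x∈S → x∈p∩q⁺ (proj₁ S-packing x∈S , S⊆U x∈S))
    λ x∈S y∈S x≢y → Packing⇒¬Conflict G S-packing x∈S y∈S x≢y ∘
      map-⊎ (within-induced⁻ (adj (host G))) (within-induced⁻ (ext (host G)))

  Packing-induced⁻ : ∀ {S} → IsTwoPacking (induced G U) S → IsTwoPacking G S
  Packing-induced⁻ {S} S-packing = ¬Conflict⇒Packing G (proj₁ ∘ x∈p∩q⁻ _ _ ∘ proj₁ S-packing)
    λ x∈S y∈S x≢y → Packing⇒¬Conflict (induced G U) S-packing x∈S y∈S x≢y ∘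
      map-⊎ (within-induced⁺ (adj (host G)) (inU x∈S) (inU y∈S))
            (within-induced⁺ (ext (host G)) (inU x∈S) (inU y∈S))
    where
    inU : ∀ {x} → x ∈ S → x ∈ U
    inU x∈S = proj₂ (x∈p∩q⁻ (V G) U (proj₁ S-packing x∈S))

module SimplicialVertex {n : ℕ} (G : ExtGraph n) {v : Fin n} (v∈V : v ∈ V G)
                        (simplicial : IsSimplicial G v) where

  A : Subset n
  A = N²[_] G v

  ∣S∩A∣≤1 : ∀ {S} → IsTwoPacking G S → ∣ S ∩ A ∣ ≤ 1
  ∣S∩A∣≤1 {S} S-packing = ∣p∣≤1 (S ∩ A) unique
    where
    unique : ∀ {x y} → x ∈ S ∩ A → y ∈ S ∩ A → x ≡ y
    unique {x} {y} x∈ y∈ with x ≟ y | x∈p∩q⁻ S A x∈ | x∈p∩q⁻ S A y∈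
    ... | yes x≡y | _ | _ = x≡y
    ... | no x≢y | x∈S , x∈A | y∈S , y∈A =
      contradiction (simplicial x∈A y∈A x≢y) (Packing⇒¬Conflict G S-packing x∈S y∈S x≢y)

  ∣S∣≤∣S∩∁A∣+1 : ∀ {S} → IsTwoPacking G S → ∣ S ∣ ≤ ∣ S ∩ ∁ A ∣ + 1
  ∣S∣≤∣S∩∁A∣+1 {S} S-packing =
    ≤-trans (≤-reflexive (∣p∣≡∣p∩∁q∣+∣p∩q∣ S A)) (+-monoʳ-≤ ∣ S ∩ ∁ A ∣ (∣S∩A∣≤1 S-packing))

  ⊆∁A⇒v∉ : ∀ {X} → X ⊆ ∁ A → v ∉ X
  ⊆∁A⇒v∉ X⊆∁A v∈X = x∈∁p⇒x∉p (X⊆∁A v∈X) (v∈N²[v] G v)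

  Packing-∪-⁅v⁆ : ∀ {X} → IsTwoPacking G X → X ⊆ ∁ A → IsTwoPacking G (X ∪ ⁅ v ⁆)
  Packing-∪-⁅v⁆ {X} X-packing X⊆∁A = ¬Conflict⇒Packing G X∪v⊆V free
    where
    X∪v⊆V : X ∪ ⁅ v ⁆ ⊆ V G
    X∪v⊆V x∈ with x∈p∪q⁻ X ⁅ v ⁆ x∈
    ... | inj₁ x∈X = proj₁ X-packing x∈X
    ... | inj₂ x≡v = subst (_∈ V G) (sym (x∈⁅y⁆⇒x≡y v x≡v)) v∈V

    ¬Conflict-v : ∀ {x} → x ∈ X → ¬ Conflict G x v
    ¬Conflict-v x∈X c = x∈∁p⇒x∉p (X⊆∁A x∈X) (Conflict⇒∈N²[] G c)

    free : ∀ {x y} → x ∈ X ∪ ⁅ v ⁆ → y ∈ X ∪ ⁅ v ⁆ → x ≢ y → ¬ Conflict G x y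
    free x∈ y∈ x≢y with x∈p∪q⁻ X ⁅ v ⁆ x∈ | x∈p∪q⁻ X ⁅ v ⁆ y∈
    ... | inj₁ x∈X | inj₁ y∈X = Packing⇒¬Conflict G X-packing x∈X y∈X x≢y
    ... | inj₁ x∈X | inj₂ y≡v rewrite x∈⁅y⁆⇒x≡y v y≡v = ¬Conflict-v x∈X
    ... | inj₂ x≡v | inj₁ y∈X rewrite x∈⁅y⁆⇒x≡y v x≡v = ¬Conflict-v y∈X ∘ Conflict-sym G
    ... | inj₂ x≡v | inj₂ y≡v =
      contradiction (trans (x∈⁅y⁆⇒x≡y v x≡v) (sym (x∈⁅y⁆⇒x≡y v y≡v))) x≢y

  ∃-maximumTwoPacking∋v : Σ[ S ∈ Subset n ] (IsMaxTwoPacking G S × v ∈ S)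
  ∃-maximumTwoPacking∋v with ∃-maximumTwoPacking G
  ... | S , S-packing , S-max =
    S ∩ ∁ A ∪ ⁅ v ⁆ , (swapped-packing , swapped-max) , x∈p∪q⁺ (inj₂ (x∈⁅x⁆ v))
    where
    swapped-packing : IsTwoPacking G (S ∩ ∁ A ∪ ⁅ v ⁆)
    swapped-packing = Packing-∪-⁅v⁆ (Packing-⊆ G (p∩q⊆p S (∁ A)) S-packing) (p∩q⊆q S (∁ A))

    swapped-max : ∀ T → IsTwoPacking G T → ∣ T ∣ ≤ ∣ S ∩ ∁ A ∪ ⁅ v ⁆ ∣
    swapped-max T T-packing = ≤-trans (S-max T T-packing) (≤-trans (∣S∣≤∣S∩∁A∣+1 S-packing)
      (x∉p⇒∣p∣+1≤∣p∪⁅x⁆∣ (S ∩ ∁ A) (⊆∁A⇒v∉ (p∩q⊆q S (∁ A)))))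

  β-reduction : ∀ S S′ → IsMaxTwoPacking G S → IsMaxTwoPacking (induced G (∁ A)) S′ →
                ∣ S ∣ ≡ ∣ S′ ∣ + 1
  β-reduction S S′ (S-packing , S-max) (S′-packing , S′-max) = ≤-antisym
    (≤-trans (∣S∣≤∣S∩∁A∣+1 S-packing) (+-monoˡ-≤ 1 (S′-max (S ∩ ∁ A)
      (Packing-induced⁺ G (∁ A) (Packing-⊆ G (p∩q⊆p S (∁ A)) S-packing) (p∩q⊆q S (∁ A))))))
    (≤-trans (x∉p⇒∣p∣+1≤∣p∪⁅x⁆∣ S′ (⊆∁A⇒v∉ S′⊆∁A))
      (S-max (S′ ∪ ⁅ v ⁆) (Packing-∪-⁅v⁆ (Packing-induced⁻ G (∁ A) S′-packing) S′⊆∁A)))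
    where
    S′⊆∁A : S′ ⊆ ∁ A
    S′⊆∁A x∈S′ = proj₂ (x∈p∩q⁻ (V G) (∁ A) (proj₁ S′-packing x∈S′))

module TwinNeighbours {n : ℕ} (G : ExtGraph n) {v u : Fin n} (u∈Nv : u ∈ N G v)
                      (twins : ∀ {x} → x ∈ N G v → N G x ≡ N G u) where

  Nu∖v⊆N²v : N G u ∩ ∁ ⁅ v ⁆ ⊆ N² G v
  Nu∖v⊆N²v {y} y∈ with x∈p∩q⁻ (N G u) (∁ ⁅ v ⁆) y∈
  ... | y∈Nu , y∉⁅v⁆
    with common-neighbour⇒Conflict G y∈Nu (∈N-sym G u∈Nv) (x∉⁅y⁆⇒x≢y (x∈∁p⇒x∉p y∉⁅v⁆))
  ... | inj₂ 𝓔yv = ∈-tabulate⁺ _ 𝓔yv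
  ... | inj₁ Eyv = contradiction (subst (y ∈_) (sym (twins (∈-tabulate⁺ _ Eyv))) y∈Nu) (∉N-self G)

  N²v⊆Nu∖v : deg₂ G v ≤ deg G u ∸ 1 → N² G v ⊆ N G u ∩ ∁ ⁅ v ⁆
  N²v⊆Nu∖v deg₂≤ {x} x∈N² with x ∈? N G u ∩ ∁ ⁅ v ⁆
  ... | yes x∈ = x∈
  ... | no x∉  = contradiction (≤-trans deg₂≤ deg∸1≤)
                   (<⇒≱ (p⊂q⇒∣p∣<∣q∣ (Nu∖v⊆N²v , x , x∈N² , x∉)))
    where
    deg∸1≤ : deg G u ∸ 1 ≤ ∣ N G u ∩ ∁ ⁅ v ⁆ ∣
    deg∸1≤ = m≤n+o⇒m∸n≤o (deg G u) 1 (subst (deg G u ≤_)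
      (trans (cong (∣ N G u ∩ ∁ ⁅ v ⁆ ∣ +_) (∣⁅x⁆∣≡1 v)) (+-comm _ 1))
      (∣p∣≤∣p∩∁q∣+∣q∣ (N G u) ⁅ v ⁆))

  twin-Conflict : N² G v ⊆ N G u → ∀ {x y} → x ∈ N G v → y ∈ N² G v → Conflict G y x
  twin-Conflict N²⊆Nu {x} {y} x∈Nv y∈N² =
    ∈N⇒Conflict G (subst (y ∈_) (sym (twins x∈Nv)) (N²⊆Nu y∈N²))

  isSimplicial : N² G v ⊆ N G u → IsSimplicial G v
  isSimplicial N²⊆Nu x∈ y∈ x≢y with ∈N²[]⁻ G x∈ | ∈N²[]⁻ G y∈
  ... | inj₂ (inj₂ refl) | _                = Conflict-sym G (∈N²[]⇒Conflict G y∈ (x≢y ∘ sym))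
  ... | _                | inj₂ (inj₂ refl) = ∈N²[]⇒Conflict G x∈ x≢y
  ... | inj₂ (inj₁ x∈Nv) | inj₂ (inj₁ y∈Nv) = common-neighbour⇒Conflict G x∈Nv y∈Nv x≢y
  ... | inj₂ (inj₁ x∈Nv) | inj₁ y∈N²        = Conflict-sym G (twin-Conflict N²⊆Nu x∈Nv y∈N²)
  ... | inj₁ x∈N²        | inj₂ (inj₁ y∈Nv) = twin-Conflict N²⊆Nu y∈Nv x∈N²
  ... | inj₁ x∈N²        | inj₁ y∈N²        =
    common-neighbour⇒Conflict G (N²⊆Nu x∈N²) (N²⊆Nu y∈N²) x≢y

mainTheorem11 : ∀ {n} (G : ExtGraph n) (v u w : Fin n) →
    v ∈ V G →
    deg G v ≡ 2 →
    N G v ≡ ⁅ u ⁆ ∪ ⁅ w ⁆ →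
    N G u ≡ N G w →
    deg₂ G v ≤ deg G u ∸ 1 →
    (Σ[ S ∈ _ ] (IsMaxTwoPacking G S × v ∈ S))
    × (∀ S S' → IsMaxTwoPacking G S →
         IsMaxTwoPacking (induced G (∁ (N²[_] G v))) S' →
         ∣ S ∣ ≡ ∣ S' ∣ + 1)
mainTheorem11 G v u w v∈V _ Nv≡u,w Nu≡Nw deg₂≤ = ∃-maximumTwoPacking∋v , β-reduction
  where
  u∈Nv : u ∈ N G v
  u∈Nv = subst (u ∈_) (sym Nv≡u,w) (x∈p∪q⁺ (inj₁ (x∈⁅x⁆ u)))

  twins : ∀ {x} → x ∈ N G v → N G x ≡ N G u
  twins {x} x∈Nv with x∈p∪q⁻ ⁅ u ⁆ ⁅ w ⁆ (subst (x ∈_) Nv≡u,w x∈Nv)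
  ... | inj₁ x∈⁅u⁆ = cong (N G) (x∈⁅y⁆⇒x≡y u x∈⁅u⁆)
  ... | inj₂ x∈⁅w⁆ = trans (cong (N G) (x∈⁅y⁆⇒x≡y w x∈⁅w⁆)) (sym Nu≡Nw)

  open TwinNeighbours G u∈Nv twins
  open SimplicialVertex G v∈V (isSimplicial (p∩q⊆p _ _ ∘ N²v⊆Nu∖v deg₂≤))
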